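{- Let $1\le k\le d$ and let $p_1,\dots,p_k\in\mathbb{R}^d$ be such that $\sigma(p_1,\dots,p_k)$ is defined. Then \[\sigma(p_1,\dots,p_k)=\frac{\overrightarrow{D}_k(p_1,\dots,p_k)}{D_{k-1}(p_1,\dots,p_k)},\] where $\overrightarrow{D}_k(T)=(D_k(T),D_{k+1}(T),\dots,D_d(T))\in\mathbb{R}^{d-k+1}$.
   Context: For $x,y\in\mathbb{R}^{m+1}$ with $x_1\ne y_1$, $\sigma(x,y)=\left(\frac{x_2-y_2}{x_1-y_1},\dots,\frac{x_{m+1}-y_{m+1}}{x_1-y_1}\right)\in\mathbb{R}^m$; further $\sigma(p)=p$ and $\sigma(p_1,\dots,p_{k+1})=\sigma(\sigma(p_1,\dots,p_k),\sigma(p_2,\dots,p_{k+1}))$, "defined" meaning all denominators arising in this recursion are nonzero. For points $q\in\mathbb{R}^d$ set $q_0:=1$. For an $m$-tuple $T=(q_1,\dots,q_m)$ of points of $\mathbb{R}^d$ and $m-1\le j\le d$, $D_j(T)$ is the determinant of the $m\times m$ matrix whose rows are $(q_{1,r},\dots,q_{m,r})$ for $r=0,1,\dots,m-2$ followed by $(q_{1,j},\dots,q_{m,j})$ (for $m\ge2$: a row of ones, coordinate rows $1,\dots,m-2$, then coordinate row $j$; for $m=1$: $D_j(q)=q_j$, so $D_0(q)=1$). -}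

module Defs where

open import Level using (Level; _⊔_) renaming (suc to lsuc)
open import Algebra.Bundles using (CommutativeRing)
open import Relation.Nullary using (¬_; does)
open import Data.Bool using (if_then_else_)
open import Data.Nat as ℕ using (ℕ; zero; suc; _∸_)
open import Data.Fin using (Fin; zero; suc; toℕ; punchIn)
open import Data.Vec as Vec using (Vec; []; _∷_; lookup)
open import Data.List as List using (List; []; _∷_; zipWith)

-- A field: a commutative ring with 0 ≠ 1 in which every nonzero element
-- has a multiplicative inverse.  (ℝ is the intended instance.)
record Field (c ℓ : Level) : Set (lsuc (c ⊔ ℓ)) where
  field
    commutativeRing : CommutativeRing c ℓ
  open CommutativeRing commutativeRing public
  field
    inv     : (x : Carrier) → ¬ (x ≈ 0#) → Carrier
    inverse : (x : Carrier) (nz : ¬ (x ≈ 0#)) → x * inv x nz ≈ 1#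
    0≉1     : ¬ (0# ≈ 1#)

vinit : ∀ {a} {A : Set a} {n} → Vec A (suc n) → Vec A n
vinit (x ∷ []) = []
vinit (x ∷ y ∷ xs) = x ∷ vinit (y ∷ xs)

module FieldDefs {c ℓ} (F : Field c ℓ) where
  open Field F using (Carrier; _≈_; _+_; _*_; -_; _-_; 0#; 1#; inv)

  σ₂ : (x₁ : Carrier) (xs : List Carrier) (y₁ : Carrier) (ys : List Carrier) →
       ¬ ((x₁ - y₁) ≈ 0#) → List Carrier
  σ₂ x₁ xs y₁ ys nz = zipWith (λ a b → (a - b) * inv (x₁ - y₁) nz) xs ys

  -- Sig ps v : "σ(p₁,…,pₖ) is defined (all denominators in the recursion
  -- are nonzero) and equals v".  Points are coordinate lists.
  data Sig : ∀ {n} → Vec (List Carrier) n → List Carrier → Set (c ⊔ ℓ) where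
    base : (p : List Carrier) → Sig (p ∷ []) p
    step : ∀ {k} {ps : Vec (List Carrier) (suc (suc k))}
             {x₁ y₁ : Carrier} {xs ys : List Carrier} →
           Sig (vinit ps) (x₁ ∷ xs) →
           Sig (Vec.tail ps) (y₁ ∷ ys) →
           (nz : ¬ ((x₁ - y₁) ≈ 0#)) →
           Sig ps (σ₂ x₁ xs y₁ ys nz)

  nth : List Carrier → ℕ → Carrier
  nth [] _ = 0#
  nth (x ∷ xs) zero = x
  nth (x ∷ xs) (suc i) = nth xs i

  -- coordinate r of a point q ∈ ℝᵈ with the convention q₀ = 1
  coord : ∀ {d} → Vec Carrier d → ℕ → Carrier
  coord q zero = 1#
  coord q (suc i) = nth (Vec.toList q) i

  sumF : ∀ n → (Fin n → Carrier) → Carrier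
  sumF zero f = 0#
  sumF (suc n) f = f zero + sumF n (λ i → f (suc i))

  sgn : ℕ → Carrier
  sgn zero = 1#
  sgn (suc i) = - sgn i

  det : ∀ n → (Fin n → Fin n → Carrier) → Carrier
  det zero M = 1#
  det (suc n) M =
    sumF (suc n) (λ j → sgn (toℕ j) * M zero j * det n (λ a b → M (suc a) (punchIn j b)))

  -- row a of the matrix for D_j with m points: coordinate a for a ≤ m-2,
  -- coordinate j for the last row a = m-1
  rowIdx : ∀ m → ℕ → Fin m → ℕ
  rowIdx m j a = if does (suc (toℕ a) ℕ.≟ m) then j else toℕ a

  D : ∀ {d m} → Vec (Vec Carrier d) m → ℕ → Carrier
  D {m = m} T j = det m (λ a b → coord (lookup T b) (rowIdx m j a))

  range : ℕ → ℕ → List ℕ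
  range j₀ d = List.map (ℕ._+ j₀) (List.upTo (suc d ∸ j₀))

-- Since the recursion defining σ only ever compares adjacent points, σ(p₁,…,pₖ) being
-- defined forces the first coordinates of consecutive points to differ and gives
-- σ(p₁,…,pₖ) = σ(q₁,…,qₖ₋₁) with qᵦ = σ(pᵦ,pᵦ₊₁).  In the matrix of D_{j+1}(p₁,…,pₖ),
-- subtracting from each column its successor and expanding along the row of ones leaves
-- the matrix of D_j(q₁,…,qₖ₋₁) with column b scaled by λᵦ = pᵦ,₁ − pᵦ₊₁,₁.  So
-- D_{j+1}(p) = ±(∏ λᵦ)·D_j(q) with a nonzero factor independent of j, the quotients
-- D_j / D_{k−1} are unchanged, and induction on k reduces to k = 1, where D₀ = 1 and
-- D_j(p) = p_j.

module Submission where

open import Defs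
open import Level using (_⊔_)
open import Relation.Nullary using (¬_; yes; no; does)
open import Relation.Nullary.Decidable using (dec-true; dec-false)
open import Data.Empty using (⊥-elim)
open import Data.Bool using (if_then_else_)
open import Data.Bool.Properties using (if-float)
open import Data.Product using (Σ; ∃; _,_; proj₁; proj₂; _×_)
open import Data.Nat as ℕ using (ℕ; zero; suc; _≤_; _<_; _∸_; s≤s)
import Data.Nat.Properties as ℕ
open import Data.Fin as Fin using (Fin; zero; suc; toℕ; punchIn; fromℕ; fromℕ<; inject₁)
import Data.Fin.Properties as Fin
open import Data.Vec as Vec using (Vec; []; _∷_; lookup)
open import Data.List as List using (List)
import Data.List.Properties as List
open import Data.List.Relation.Binary.Pointwise using (Pointwise; []; _∷_)
import Data.Vec.Relation.Binary.Pointwise.Inductive as Vecʷ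
open import Data.Unit.Polymorphic using (⊤)
open import Data.Maybe using (nothing)
open import Relation.Binary.PropositionalEquality as ≡ using (_≡_; _≢_)

punchIn-fromℕ : ∀ {n} (b : Fin n) → punchIn (fromℕ n) b ≡ inject₁ b
punchIn-fromℕ zero = ≡.refl
punchIn-fromℕ (suc b) = ≡.cong suc (punchIn-fromℕ b)

punchIn-inject₁-self : ∀ {n} (i : Fin n) → punchIn (inject₁ i) i ≡ suc i
punchIn-inject₁-self zero = ≡.refl
punchIn-inject₁-self (suc i) = ≡.cong suc (punchIn-inject₁-self i)

punchIn-suc-self : ∀ {n} (i : Fin n) → punchIn (suc i) i ≡ inject₁ i
punchIn-suc-self zero = ≡.refl
punchIn-suc-self (suc i) = ≡.cong suc (punchIn-suc-self i)

punchIn-inject₁≡punchIn-suc : ∀ {n} (i b : Fin n) → b ≢ i → punchIn (inject₁ i) b ≡ punchIn (suc i) b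
punchIn-inject₁≡punchIn-suc zero zero b≢i = ⊥-elim (b≢i ≡.refl)
punchIn-inject₁≡punchIn-suc zero (suc b) _ = ≡.refl
punchIn-inject₁≡punchIn-suc (suc i) zero _ = ≡.refl
punchIn-inject₁≡punchIn-suc (suc i) (suc b) b≢i =
  ≡.cong suc (punchIn-inject₁≡punchIn-suc i b (λ b≡i → b≢i (≡.cong suc b≡i)))

punchIn-adjacent : ∀ {n} (j : Fin (suc (suc n))) (i : Fin (suc n)) → j ≢ inject₁ i → j ≢ suc i →
  ∃ λ (i′ : Fin n) → punchIn j (inject₁ i′) ≡ inject₁ i × punchIn j (suc i′) ≡ suc i
punchIn-adjacent zero zero j≢i _ = ⊥-elim (j≢i ≡.refl)
punchIn-adjacent zero (suc i) _ _ = i , ≡.refl , ≡.refl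
punchIn-adjacent (suc zero) zero _ j≢1+i = ⊥-elim (j≢1+i ≡.refl)
punchIn-adjacent {suc n} (suc (suc j)) zero _ _ = zero , ≡.refl , ≡.refl
punchIn-adjacent {suc n} (suc j) (suc i) j≢i j≢1+i
  with punchIn-adjacent j i (λ e → j≢i (≡.cong suc e)) (λ e → j≢1+i (≡.cong suc e))
... | i′ , e₁ , e₂ = suc i′ , ≡.cong suc e₁ , ≡.cong suc e₂

next : ∀ {n} → Fin (suc n) → Fin (suc n)
next {zero} zero = zero
next {suc n} zero = suc zero
next {suc n} (suc b) = suc (next b)

next-inject₁ : ∀ {n} (b : Fin n) → next (inject₁ b) ≡ suc b
next-inject₁ zero = ≡.refl
next-inject₁ (suc b) = ≡.cong suc (next-inject₁ b)

suc≢inject₁ : ∀ {n} (i : Fin n) → suc i ≢ inject₁ i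
suc≢inject₁ i e = ℕ.1+n≢n (≡.trans (≡.cong toℕ e) (Fin.toℕ-inject₁ i))

vinit-map : ∀ {a b} {A : Set a} {B : Set b} {n} (f : A → B) (xs : Vec A (suc n)) →
  vinit (Vec.map f xs) ≡ Vec.map f (vinit xs)
vinit-map f (x ∷ []) = ≡.refl
vinit-map f (x ∷ y ∷ xs) = ≡.cong (f x ∷_) (vinit-map f (y ∷ xs))

module _ {c ℓ} (F : Field c ℓ) where
  open Field F hiding (zero)
  open FieldDefs F
  open import Algebra.Solver.Ring.NaturalCoefficients commutativeSemiring (λ _ _ → nothing)
    using (solve; _:+_; _:*_; _:=_)
  open import Algebra.Properties.Ring ring using (-‿involutive; -0#≈0#; -1*x≈-x; -‿distribˡ-*)
  open import Algebra.Properties.CommutativeSemigroup *-commutativeSemigroup using (x∙yz≈y∙xz; x∙yz≈yx∙z)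
  open import Relation.Binary.Reasoning.Setoid setoid
  open import Data.List.Relation.Binary.Equality.Setoid setoid using (_≋_; ≋-refl; ≋-sym; ≋-trans; ≋-reflexive)

  1≉0 : ¬ (1# ≈ 0#)
  1≉0 1≈0 = 0≉1 (sym 1≈0)

  inv-cong : ∀ {x y} (x≉0 : ¬ (x ≈ 0#)) (y≉0 : ¬ (y ≈ 0#)) → x ≈ y → inv x x≉0 ≈ inv y y≉0
  inv-cong {x} {y} x≉0 y≉0 x≈y = begin
    inv x x≉0                   ≈⟨ sym (*-identityʳ _) ⟩
    inv x x≉0 * 1#              ≈⟨ *-congˡ (sym (inverse y y≉0)) ⟩
    inv x x≉0 * (y * inv y y≉0) ≈⟨ x∙yz≈yx∙z (inv x x≉0) y (inv y y≉0) ⟩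
    y * inv x x≉0 * inv y y≉0   ≈⟨ *-congʳ (*-congʳ (sym x≈y)) ⟩
    x * inv x x≉0 * inv y y≉0   ≈⟨ *-congʳ (inverse x x≉0) ⟩
    1# * inv y y≉0              ≈⟨ *-identityˡ _ ⟩
    inv y y≉0                   ∎

  inv-1 : inv 1# 1≉0 ≈ 1#
  inv-1 = trans (sym (*-identityˡ _)) (inverse 1# 1≉0)

  x*y≉0 : ∀ {x y} → ¬ (x ≈ 0#) → ¬ (y ≈ 0#) → ¬ (x * y ≈ 0#)
  x*y≉0 {x} {y} x≉0 y≉0 xy≈0 = y≉0 (begin
    y                   ≈⟨ sym (*-identityʳ _) ⟩
    y * 1#              ≈⟨ *-congˡ (sym (inverse x x≉0)) ⟩
    y * (x * inv x x≉0) ≈⟨ x∙yz≈yx∙z y x (inv x x≉0) ⟩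
    x * y * inv x x≉0   ≈⟨ *-congʳ xy≈0 ⟩
    0# * inv x x≉0      ≈⟨ zeroˡ _ ⟩
    0#                  ∎)

  sgn≉0 : ∀ n → ¬ (sgn n ≈ 0#)
  sgn≉0 zero = 1≉0
  sgn≉0 (suc n) -s≈0 = sgn≉0 n (trans (sym (-‿involutive _)) (trans (-‿cong -s≈0) -0#≈0#))

  quotient-cancel : ∀ {x y K a b} (y≉0 : ¬ (y ≈ 0#)) (b≉0 : ¬ (b ≈ 0#)) →
    x ≈ K * a → y ≈ K * b → x * inv y y≉0 ≈ a * inv b b≉0
  quotient-cancel {x} {y} {K} {a} {b} y≉0 b≉0 x≈Ka y≈Kb = sym (begin
    a * inv b b≉0                         ≈⟨ sym (*-identityʳ _) ⟩
    a * inv b b≉0 * 1#                    ≈⟨ *-congˡ (sym (inverse y y≉0)) ⟩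
    a * inv b b≉0 * (y * inv y y≉0)       ≈⟨ *-congˡ (*-congʳ y≈Kb) ⟩
    a * inv b b≉0 * (K * b * inv y y≉0)   ≈⟨ regroup a (inv b b≉0) K b (inv y y≉0) ⟩
    K * a * inv y y≉0 * (b * inv b b≉0)   ≈⟨ *-cong (*-congʳ (sym x≈Ka)) (inverse b b≉0) ⟩
    x * inv y y≉0 * 1#                    ≈⟨ *-identityʳ _ ⟩
    x * inv y y≉0                         ∎)
    where
    regroup : ∀ a ib K b iy → a * ib * (K * b * iy) ≈ K * a * iy * (b * ib)
    regroup = solve 5 (λ a ib K b iy → a :* ib :* (K :* b :* iy) := K :* a :* iy :* (b :* ib)) refl

  sumF-cong : ∀ n {f g : Fin n → Carrier} → (∀ i → f i ≈ g i) → sumF n f ≈ sumF n g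
  sumF-cong zero f≈g = refl
  sumF-cong (suc n) f≈g = +-cong (f≈g zero) (sumF-cong n (λ i → f≈g (suc i)))

  sumF-zero : ∀ n {f : Fin n → Carrier} → (∀ i → f i ≈ 0#) → sumF n f ≈ 0#
  sumF-zero zero f≈0 = refl
  sumF-zero (suc n) f≈0 = trans (+-cong (f≈0 zero) (sumF-zero n (λ i → f≈0 (suc i)))) (+-identityʳ 0#)

  sumF-linear : ∀ n t {f g h : Fin n → Carrier} → (∀ i → f i ≈ g i + t * h i) →
    sumF n f ≈ sumF n g + t * sumF n h
  sumF-linear zero t _ = sym (trans (+-congˡ (zeroʳ t)) (+-identityʳ 0#))
  sumF-linear (suc n) t {f} {g} {h} f≈g+th = trans
    (+-cong (f≈g+th zero) (sumF-linear n t (λ i → f≈g+th (suc i))))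
    (regroup (g zero) (h zero) (sumF n (λ i → g (suc i))) (sumF n (λ i → h (suc i))) t)
    where
    regroup : ∀ a b x y t → a + t * b + (x + t * y) ≈ a + x + t * (b + y)
    regroup = solve 5 (λ a b x y t → a :+ t :* b :+ (x :+ t :* y) := a :+ x :+ t :* (b :+ y)) refl

  sumF-scale : ∀ n t {f g : Fin n → Carrier} → (∀ i → f i ≈ t * g i) → sumF n f ≈ t * sumF n g
  sumF-scale zero t _ = sym (zeroʳ t)
  sumF-scale (suc n) t f≈tg =
    trans (+-cong (f≈tg zero) (sumF-scale n t (λ i → f≈tg (suc i)))) (sym (distribˡ t _ _))

  sumF-adjacent-cancel : ∀ {n} {f : Fin (suc n) → Carrier} (i : Fin n) →
    (∀ j → j ≢ inject₁ i → j ≢ suc i → f j ≈ 0#) → f (inject₁ i) + f (suc i) ≈ 0# →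
    sumF (suc n) f ≈ 0#
  sumF-adjacent-cancel {suc n} {f} zero others pair = begin
    f zero + (f (suc zero) + sumF n (λ j → f (suc (suc j))))
      ≈⟨ +-congˡ (+-congˡ (sumF-zero n (λ j → others (suc (suc j)) (λ ()) (λ ())))) ⟩
    f zero + (f (suc zero) + 0#) ≈⟨ +-congˡ (+-identityʳ _) ⟩
    f zero + f (suc zero)        ≈⟨ pair ⟩
    0#                           ∎
  sumF-adjacent-cancel {suc n} {f} (suc i) others pair = trans
    (+-cong (others zero (λ ()) (λ ()))
      (sumF-adjacent-cancel i (λ j j≢i j≢1+i → others (suc j) (λ e → j≢i (Fin.suc-injective e))
                                                               (λ e → j≢1+i (Fin.suc-injective e)))
        pair))
    (+-identityʳ 0#)

  sumF-last : ∀ n {f : Fin (suc n) → Carrier} → (∀ j → f (inject₁ j) ≈ 0#) → sumF (suc n) f ≈ f (fromℕ n)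
  sumF-last zero _ = +-identityʳ _
  sumF-last (suc n) {f} f∘inject₁≈0 = trans
    (+-cong (f∘inject₁≈0 zero) (sumF-last n {λ i → f (suc i)} (λ j → f∘inject₁≈0 (suc j))))
    (+-identityˡ _)

  prodF : ∀ n → (Fin n → Carrier) → Carrier
  prodF zero f = 1#
  prodF (suc n) f = f zero * prodF n (λ i → f (suc i))

  prodF-punchIn : ∀ n (f : Fin (suc n) → Carrier) (j : Fin (suc n)) →
    prodF (suc n) f ≈ f j * prodF n (λ b → f (punchIn j b))
  prodF-punchIn n f zero = refl
  prodF-punchIn (suc n) f (suc j) =
    trans (*-congˡ (prodF-punchIn n (λ i → f (suc i)) j)) (x∙yz≈y∙xz _ _ _)

  prodF≉0 : ∀ n (f : Fin n → Carrier) → (∀ b → ¬ (f b ≈ 0#)) → ¬ (prodF n f ≈ 0#)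
  prodF≉0 zero f _ = 1≉0
  prodF≉0 (suc n) f f≉0 = x*y≉0 (f≉0 zero) (prodF≉0 n (λ i → f (suc i)) (λ i → f≉0 (suc i)))

  Matrix : ℕ → Set c
  Matrix n = Fin n → Fin n → Carrier

  minor : ∀ {n} → Matrix (suc n) → Fin (suc n) → Matrix n
  minor M j a b = M (suc a) (punchIn j b)

  laplaceTerm : ∀ {n} → Matrix (suc n) → Fin (suc n) → Carrier
  laplaceTerm {n} M j = sgn (toℕ j) * M zero j * det n (minor M j)

  det-cong : ∀ n {M N : Matrix n} → (∀ a b → M a b ≈ N a b) → det n M ≈ det n N
  det-cong zero _ = refl
  det-cong (suc n) M≈N = sumF-cong (suc n) (λ j →
    *-cong (*-congˡ {sgn (toℕ j)} (M≈N zero j)) (det-cong n (λ a b → M≈N (suc a) (punchIn j b))))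

  det-linear-column : ∀ n (k : Fin n) t {M N P : Matrix n} →
    (∀ a b → b ≢ k → M a b ≈ N a b) → (∀ a b → b ≢ k → M a b ≈ P a b) →
    (∀ a → M a k ≈ N a k + t * P a k) → det n M ≈ det n N + t * det n P
  det-linear-column (suc n) k t {M} {N} {P} M≈N M≈P Mₖ≈Nₖ+tPₖ = sumF-linear (suc n) t term-linear
    where
    term-linear : ∀ j → laplaceTerm M j ≈ laplaceTerm N j + t * laplaceTerm P j
    term-linear j with j Fin.≟ k
    ... | yes ≡.refl = begin
      sgn (toℕ j) * M zero j * det n (minor M j)
        ≈⟨ *-congʳ (*-congˡ (Mₖ≈Nₖ+tPₖ zero)) ⟩
      sgn (toℕ j) * (N zero j + t * P zero j) * det n (minor M j)
        ≈⟨ distribute (sgn (toℕ j)) (N zero j) (P zero j) t (det n (minor M j)) ⟩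
      sgn (toℕ j) * N zero j * det n (minor M j) + t * (sgn (toℕ j) * P zero j * det n (minor M j))
        ≈⟨ +-cong (*-congˡ (det-cong n (λ a b → M≈N (suc a) (punchIn j b) (Fin.punchInᵢ≢i j b))))
                  (*-congˡ (*-congˡ (det-cong n (λ a b → M≈P (suc a) (punchIn j b) (Fin.punchInᵢ≢i j b))))) ⟩
      laplaceTerm N j + t * laplaceTerm P j ∎
      where
      distribute : ∀ s x y t d → s * (x + t * y) * d ≈ s * x * d + t * (s * y * d)
      distribute = solve 5 (λ s x y t d → s :* (x :+ t :* y) :* d := s :* x :* d :+ t :* (s :* y :* d)) refl
    ... | no j≢k = begin
      sgn (toℕ j) * M zero j * det n (minor M j)
        ≈⟨ *-congˡ (det-linear-column n k′ t minor-M≈N minor-M≈P minor-column) ⟩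
      sgn (toℕ j) * M zero j * (det n (minor N j) + t * det n (minor P j))
        ≈⟨ distribute (sgn (toℕ j) * M zero j) (det n (minor N j)) (det n (minor P j)) t ⟩
      sgn (toℕ j) * M zero j * det n (minor N j) + t * (sgn (toℕ j) * M zero j * det n (minor P j))
        ≈⟨ +-cong (*-congʳ (*-congˡ (M≈N zero j j≢k))) (*-congˡ (*-congʳ (*-congˡ (M≈P zero j j≢k)))) ⟩
      laplaceTerm N j + t * laplaceTerm P j ∎
      where
      k′ : Fin n
      k′ = Fin.punchOut j≢k
      punchIn≢k : ∀ b → b ≢ k′ → punchIn j b ≢ k
      punchIn≢k b b≢k′ e = b≢k′ (Fin.punchIn-injective j b k′ (≡.trans e (≡.sym (Fin.punchIn-punchOut j≢k))))
      minor-M≈N : ∀ a b → b ≢ k′ → minor M j a b ≈ minor N j a b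
      minor-M≈N a b b≢k′ = M≈N (suc a) (punchIn j b) (punchIn≢k b b≢k′)
      minor-M≈P : ∀ a b → b ≢ k′ → minor M j a b ≈ minor P j a b
      minor-M≈P a b b≢k′ = M≈P (suc a) (punchIn j b) (punchIn≢k b b≢k′)
      minor-column : ∀ a → minor M j a k′ ≈ minor N j a k′ + t * minor P j a k′
      minor-column a rewrite Fin.punchIn-punchOut j≢k = Mₖ≈Nₖ+tPₖ (suc a)
      distribute : ∀ m x y t → m * (x + t * y) ≈ m * x + t * (m * y)
      distribute = solve 4 (λ m x y t → m :* (x :+ t :* y) := m :* x :+ t :* (m :* y)) refl

  det-scale-columns : ∀ n (l : Fin n → Carrier) {M Q : Matrix n} →
    (∀ a b → M a b ≈ l b * Q a b) → det n M ≈ prodF n l * det n Q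
  det-scale-columns zero l _ = sym (*-identityʳ _)
  det-scale-columns (suc n) l {M} {Q} M≈lQ = sumF-scale (suc n) (prodF (suc n) l) term-scale
    where
    term-scale : ∀ j → laplaceTerm M j ≈ prodF (suc n) l * laplaceTerm Q j
    term-scale j = begin
      sgn (toℕ j) * M zero j * det n (minor M j)
        ≈⟨ *-cong (*-congˡ (M≈lQ zero j))
                  (det-scale-columns n (λ b → l (punchIn j b)) (λ a b → M≈lQ (suc a) (punchIn j b))) ⟩
      sgn (toℕ j) * (l j * Q zero j) * (prodF n (λ b → l (punchIn j b)) * det n (minor Q j))
        ≈⟨ regroup (sgn (toℕ j)) (l j) (Q zero j) (prodF n (λ b → l (punchIn j b))) (det n (minor Q j)) ⟩
      l j * prodF n (λ b → l (punchIn j b)) * laplaceTerm Q j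
        ≈⟨ *-congʳ (sym (prodF-punchIn n l j)) ⟩
      prodF (suc n) l * laplaceTerm Q j ∎
      where
      regroup : ∀ s x q p d → s * (x * q) * (p * d) ≈ x * p * (s * q * d)
      regroup = solve 5 (λ s x q p d → s :* (x :* q) :* (p :* d) := x :* p :* (s :* q :* d)) refl

  det-adjacent-equal-columns : ∀ {n} (M : Matrix (suc n)) (i : Fin n) →
    (∀ a → M a (inject₁ i) ≈ M a (suc i)) → det (suc n) M ≈ 0#
  det-adjacent-equal-columns {suc n} M i Mᵢ≈Mᵢ₊₁ = sumF-adjacent-cancel i vanishing cancelling
    where
    vanishing : ∀ j → j ≢ inject₁ i → j ≢ suc i → laplaceTerm M j ≈ 0#
    vanishing j j≢i j≢1+i with punchIn-adjacent j i j≢i j≢1+i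
    ... | i′ , e₁ , e₂ = trans (*-congˡ (det-adjacent-equal-columns (minor M j) i′ equal)) (zeroʳ _)
      where
      equal : ∀ a → minor M j a (inject₁ i′) ≈ minor M j a (suc i′)
      equal a rewrite e₁ | e₂ = Mᵢ≈Mᵢ₊₁ (suc a)
    same-minor : ∀ a b → minor M (inject₁ i) a b ≈ minor M (suc i) a b
    same-minor a b with b Fin.≟ i
    ... | yes ≡.refl rewrite punchIn-inject₁-self b | punchIn-suc-self b = sym (Mᵢ≈Mᵢ₊₁ (suc a))
    ... | no b≢i = reflexive (≡.cong (M (suc a)) (punchIn-inject₁≡punchIn-suc i b b≢i))
    s x d : Carrier
    s = sgn (toℕ i)
    x = M zero (inject₁ i)
    d = det (suc n) (minor M (inject₁ i))
    cancelling : laplaceTerm M (inject₁ i) + laplaceTerm M (suc i) ≈ 0#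
    cancelling = begin
      sgn (toℕ (inject₁ i)) * x * d + - s * M zero (suc i) * det (suc n) (minor M (suc i))
        ≈⟨ +-cong (*-congʳ (*-congʳ (reflexive (≡.cong sgn (Fin.toℕ-inject₁ i)))))
                  (*-cong (*-congˡ (sym (Mᵢ≈Mᵢ₊₁ zero))) (sym (det-cong (suc n) same-minor))) ⟩
      s * x * d + - s * x * d
        ≈⟨ +-congˡ (trans (*-congʳ (sym (-‿distribˡ-* s x))) (sym (-‿distribˡ-* (s * x) d))) ⟩
      s * x * d + - (s * x * d)
        ≈⟨ -‿inverseʳ _ ⟩
      0# ∎

  det-subtract-next-column : ∀ {n} (k : Fin n) {M N : Matrix (suc n)} →
    (∀ a b → b ≢ inject₁ k → M a b ≈ N a b) →
    (∀ a → M a (inject₁ k) ≈ N a (inject₁ k) - N a (suc k)) → det (suc n) M ≈ det (suc n) N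
  det-subtract-next-column {n} k {M} {N} M≈N Mₖ≈Nₖ-Nₖ₊₁ = begin
    det (suc n) M                        ≈⟨ det-linear-column (suc n) (inject₁ k) (- 1#) M≈N M≈P column ⟩
    det (suc n) N + - 1# * det (suc n) P ≈⟨ +-congˡ (trans (*-congˡ P-singular) (zeroʳ _)) ⟩
    det (suc n) N + 0#                   ≈⟨ +-identityʳ _ ⟩
    det (suc n) N                        ∎
    where
    P : Matrix (suc n)
    P a b = if does (b Fin.≟ inject₁ k) then N a (suc k) else N a b
    Pₖ≡Nₖ₊₁ : ∀ a → P a (inject₁ k) ≡ N a (suc k)
    Pₖ≡Nₖ₊₁ a = ≡.cong (λ t → if t then N a (suc k) else N a (inject₁ k)) (dec-true (inject₁ k Fin.≟ inject₁ k) ≡.refl)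
    P≡N : ∀ a b → b ≢ inject₁ k → P a b ≡ N a b
    P≡N a b b≢k = ≡.cong (λ t → if t then N a (suc k) else N a b) (dec-false (b Fin.≟ inject₁ k) b≢k)
    M≈P : ∀ a b → b ≢ inject₁ k → M a b ≈ P a b
    M≈P a b b≢k = trans (M≈N a b b≢k) (reflexive (≡.sym (P≡N a b b≢k)))
    column : ∀ a → M a (inject₁ k) ≈ N a (inject₁ k) + - 1# * P a (inject₁ k)
    column a = trans (Mₖ≈Nₖ-Nₖ₊₁ a) (+-congˡ (trans (sym (-1*x≈-x _)) (*-congˡ (reflexive (≡.sym (Pₖ≡Nₖ₊₁ a))))))
    P-singular : det (suc n) P ≈ 0#
    P-singular = det-adjacent-equal-columns P k (λ a →
      reflexive (≡.trans (Pₖ≡Nₖ₊₁ a) (≡.sym (P≡N a (suc k) (suc≢inject₁ k)))))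

  partialDifferences : ∀ {n} → ℕ → Matrix (suc n) → Matrix (suc n)
  partialDifferences i M a b = if does (toℕ b ℕ.<? i) then M a b - M a (next b) else M a b

  module _ {n} (M : Matrix (suc n)) where

    partialDifferences-< : ∀ {i} a b → toℕ b < i → partialDifferences i M a b ≡ M a b - M a (next b)
    partialDifferences-< {i} a b b<i =
      ≡.cong (λ t → if t then M a b - M a (next b) else M a b) (dec-true (toℕ b ℕ.<? i) b<i)

    partialDifferences-≮ : ∀ {i} a b → ¬ (toℕ b < i) → partialDifferences i M a b ≡ M a b
    partialDifferences-≮ {i} a b b≮i =
      ≡.cong (λ t → if t then M a b - M a (next b) else M a b) (dec-false (toℕ b ℕ.<? i) b≮i)

    partialDifferences-inject₁ : ∀ {i} a (b : Fin n) → toℕ b < i →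
      partialDifferences i M a (inject₁ b) ≡ M a (inject₁ b) - M a (suc b)
    partialDifferences-inject₁ a b b<i rewrite ≡.sym (next-inject₁ b) =
      partialDifferences-< a (inject₁ b) (≡.subst (_< _) (≡.sym (Fin.toℕ-inject₁ b)) b<i)

    -- Step i turns column i into Mᵢ − Mᵢ₊₁ while column i+1 is still the original one.
    partialDifferences-step : ∀ i → i < n →
      det (suc n) (partialDifferences (suc i) M) ≈ det (suc n) (partialDifferences i M)
    partialDifferences-step i i<n = det-subtract-next-column k off-column on-column
      where
      k : Fin n
      k = fromℕ< i<n
      k≡i : toℕ k ≡ i
      k≡i = Fin.toℕ-fromℕ< i<n
      off-column : ∀ a b → b ≢ inject₁ k →
        partialDifferences (suc i) M a b ≈ partialDifferences i M a b
      off-column a b b≢k with toℕ b ℕ.<? i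
      ... | yes b<i = reflexive (≡.trans (partialDifferences-< a b (ℕ.m<n⇒m<1+n b<i))
                                         (≡.sym (partialDifferences-< a b b<i)))
      ... | no b≮i = reflexive (≡.trans (partialDifferences-≮ a b b≮1+i) (≡.sym (partialDifferences-≮ a b b≮i)))
        where
        b≢i : toℕ b ≢ i
        b≢i e = b≢k (Fin.toℕ-injective (≡.trans e (≡.sym (≡.trans (Fin.toℕ-inject₁ k) k≡i))))
        b≮1+i : ¬ (toℕ b < suc i)
        b≮1+i (s≤s b≤i) = b≮i (ℕ.≤∧≢⇒< b≤i b≢i)
      on-column : ∀ a → partialDifferences (suc i) M a (inject₁ k) ≈
        partialDifferences i M a (inject₁ k) - partialDifferences i M a (suc k)
      on-column a = reflexive (≡.trans
        (partialDifferences-inject₁ a k (ℕ.≤-reflexive (≡.cong suc k≡i)))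
        (≡.cong₂ _-_ (≡.sym (partialDifferences-≮ a (inject₁ k) (ℕ.<-irrefl (≡.trans (Fin.toℕ-inject₁ k) k≡i))))
                     (≡.sym (partialDifferences-≮ a (suc k) (λ 1+k<i → ℕ.<-irrefl k≡i (ℕ.<-trans (ℕ.n<1+n _) 1+k<i))))))

    det-partialDifferences : ∀ i → i ≤ n → det (suc n) (partialDifferences i M) ≈ det (suc n) M
    det-partialDifferences zero _ = det-cong (suc n) (λ a b → reflexive (partialDifferences-≮ {0} a b (λ ())))
    det-partialDifferences (suc i) i<n =
      trans (partialDifferences-step i i<n) (det-partialDifferences i (ℕ.<⇒≤ i<n))

    -- Subtracting from each column its successor leaves the row of ones as (0, …, 0, 1).
    det-column-differences : (∀ b → M zero b ≈ 1#) →
      det (suc n) M ≈ sgn n * det n (λ a b → M (suc a) (inject₁ b) - M (suc a) (suc b))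
    det-column-differences row₀≈1 = begin
      det (suc n) M                      ≈⟨ sym (det-partialDifferences n ℕ.≤-refl) ⟩
      det (suc n) Δ                      ≈⟨ sumF-last n {laplaceTerm Δ} first-row-vanishes ⟩
      laplaceTerm Δ (fromℕ n)            ≈⟨ *-cong (*-cong (reflexive (≡.cong sgn (Fin.toℕ-fromℕ n))) last-entry)
                                                   (det-cong n last-minor) ⟩
      sgn n * 1# * det n differences     ≈⟨ *-congʳ (*-identityʳ _) ⟩
      sgn n * det n differences          ∎
      where
      Δ : Matrix (suc n)
      Δ = partialDifferences n M
      differences : Matrix n
      differences a b = M (suc a) (inject₁ b) - M (suc a) (suc b)
      first-row-vanishes : ∀ b → laplaceTerm Δ (inject₁ b) ≈ 0#
      first-row-vanishes b = begin
        sgn (toℕ (inject₁ b)) * Δ zero (inject₁ b) * det n (minor Δ (inject₁ b))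
          ≈⟨ *-congʳ (*-congˡ (reflexive (partialDifferences-inject₁ zero b (Fin.toℕ<n b)))) ⟩
        sgn (toℕ (inject₁ b)) * (M zero (inject₁ b) - M zero (suc b)) * det n (minor Δ (inject₁ b))
          ≈⟨ *-congʳ (*-congˡ (trans (+-cong (row₀≈1 _) (-‿cong (row₀≈1 _))) (-‿inverseʳ 1#))) ⟩
        sgn (toℕ (inject₁ b)) * 0# * det n (minor Δ (inject₁ b))
          ≈⟨ trans (*-congʳ (zeroʳ _)) (zeroˡ _) ⟩
        0# ∎
      last-entry : Δ zero (fromℕ n) ≈ 1#
      last-entry = trans (reflexive (partialDifferences-≮ zero (fromℕ n) (ℕ.<-irrefl (Fin.toℕ-fromℕ n))))
                         (row₀≈1 (fromℕ n))
      last-minor : ∀ a b → minor Δ (fromℕ n) a b ≈ differences a b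
      last-minor a b rewrite punchIn-fromℕ b = reflexive (partialDifferences-inject₁ (suc a) b (Fin.toℕ<n b))

  rowIdx-suc : ∀ m j (a : Fin m) → rowIdx (suc m) (suc j) (suc a) ≡ suc (rowIdx m j a)
  rowIdx-suc m j a = ≡.sym (if-float suc (does (suc (toℕ a) ℕ.≟ m)))

  D-single : ∀ {d} (p : Vec Carrier d) j → D (p ∷ []) j ≈ coord p j
  D-single p j = trans (+-identityʳ _) (trans (*-identityʳ _) (*-identityˡ _))

  D-column-differences : ∀ {d m} (ps : Vec (Vec Carrier (suc d)) (suc (suc m)))
    (qs : Vec (Vec Carrier d) (suc m)) (l : Fin (suc m) → Carrier) →
    (∀ b r → coord (lookup ps (inject₁ b)) (suc r) - coord (lookup ps (suc b)) (suc r) ≈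
             l b * coord (lookup qs b) r) →
    ∀ j → D ps (suc j) ≈ sgn (suc m) * prodF (suc m) l * D qs j
  D-column-differences {m = m} ps qs l differences j = begin
    D ps (suc j)
      ≈⟨ det-column-differences M (λ _ → refl) ⟩
    sgn (suc m) * det (suc m) (λ a b → M (suc a) (inject₁ b) - M (suc a) (suc b))
      ≈⟨ *-congˡ (det-scale-columns (suc m) l scaled) ⟩
    sgn (suc m) * (prodF (suc m) l * D qs j)
      ≈⟨ sym (*-assoc _ _ _) ⟩
    sgn (suc m) * prodF (suc m) l * D qs j ∎
    where
    M : Matrix (suc (suc m))
    M a b = coord (lookup ps b) (rowIdx (suc (suc m)) (suc j) a)
    scaled : ∀ a b → M (suc a) (inject₁ b) - M (suc a) (suc b) ≈ l b * coord (lookup qs b) (rowIdx (suc m) j a)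
    scaled a b = trans
      (reflexive (≡.cong (λ r → coord (lookup ps (inject₁ b)) r - coord (lookup ps (suc b)) r) (rowIdx-suc (suc m) j a)))
      (differences b (rowIdx (suc m) j a))

  toLists : ∀ {d n} → Vec (Vec Carrier d) n → Vec (List Carrier) n
  toLists = Vec.map Vec.toList

  gap : ∀ {d} → Vec Carrier (suc d) → Vec Carrier (suc d) → Carrier
  gap p q = Vec.head p - Vec.head q

  σᵛ : ∀ {d} (p q : Vec Carrier (suc d)) → ¬ (gap p q ≈ 0#) → Vec Carrier d
  σᵛ p q gap≉0 = Vec.zipWith (λ a b → (a - b) * inv (gap p q) gap≉0) (Vec.tail p) (Vec.tail q)

  Separated : ∀ {d n} → Vec (Vec Carrier (suc d)) n → Set ℓ
  Separated [] = ⊤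
  Separated (p ∷ []) = ⊤
  Separated (p ∷ q ∷ ps) = ¬ (gap p q ≈ 0#) × Separated (q ∷ ps)

  σ-adjacent : ∀ {d n} (ps : Vec (Vec Carrier (suc d)) (suc n)) → Separated ps → Vec (Vec Carrier d) n
  σ-adjacent (p ∷ []) _ = []
  σ-adjacent (p ∷ q ∷ ps) (gap≉0 , sep) = σᵛ p q gap≉0 ∷ σ-adjacent (q ∷ ps) sep

  gaps : ∀ {d m} → Vec (Vec Carrier (suc d)) (suc m) → Fin m → Carrier
  gaps ps b = gap (lookup ps (inject₁ b)) (lookup ps (suc b))

  gaps≉0 : ∀ {d m} (ps : Vec (Vec Carrier (suc d)) (suc m)) → Separated ps → ∀ b → ¬ (gaps ps b ≈ 0#)
  gaps≉0 (p ∷ q ∷ ps) (gap≉0 , _) zero = gap≉0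
  gaps≉0 (p ∷ q ∷ ps) (_ , sep) (suc b) = gaps≉0 (q ∷ ps) sep b

  nth-zipWith-difference : ∀ {n} w (xs ys : Vec Carrier n) r →
    nth (Vec.toList (Vec.zipWith (λ a b → (a - b) * w) xs ys)) r ≈ (nth (Vec.toList xs) r - nth (Vec.toList ys) r) * w
  nth-zipWith-difference w [] [] r = sym (trans (*-congʳ (-‿inverseʳ 0#)) (zeroˡ w))
  nth-zipWith-difference w (x ∷ xs) (y ∷ ys) zero = refl
  nth-zipWith-difference w (x ∷ xs) (y ∷ ys) (suc r) = nth-zipWith-difference w xs ys r

  coord-σᵛ : ∀ {d} (p q : Vec Carrier (suc d)) gap≉0 r →
    coord p (suc r) - coord q (suc r) ≈ gap p q * coord (σᵛ p q gap≉0) r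
  coord-σᵛ (_ ∷ _) (_ ∷ _) gap≉0 zero = sym (*-identityʳ _)
  coord-σᵛ (x ∷ xs) (y ∷ ys) gap≉0 (suc r) = sym (begin
    (x - y) * nth (Vec.toList (σᵛ (x ∷ xs) (y ∷ ys) gap≉0)) r
      ≈⟨ *-congˡ (nth-zipWith-difference (inv (x - y) gap≉0) xs ys r) ⟩
    (x - y) * ((xᵣ - yᵣ) * inv (x - y) gap≉0) ≈⟨ x∙yz≈y∙xz (x - y) (xᵣ - yᵣ) (inv (x - y) gap≉0) ⟩
    (xᵣ - yᵣ) * ((x - y) * inv (x - y) gap≉0) ≈⟨ *-congˡ (inverse (x - y) gap≉0) ⟩
    (xᵣ - yᵣ) * 1#                            ≈⟨ *-identityʳ _ ⟩
    xᵣ - yᵣ                                   ∎)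
    where
    xᵣ = nth (Vec.toList xs) r
    yᵣ = nth (Vec.toList ys) r

  σ-adjacent-coord : ∀ {d m} (ps : Vec (Vec Carrier (suc d)) (suc (suc m))) (sep : Separated ps) b r →
    coord (lookup ps (inject₁ b)) (suc r) - coord (lookup ps (suc b)) (suc r) ≈
    gaps ps b * coord (lookup (σ-adjacent ps sep) b) r
  σ-adjacent-coord (p ∷ q ∷ ps) (gap≉0 , _) zero r = coord-σᵛ p q gap≉0 r
  σ-adjacent-coord {m = suc m} (p ∷ q ∷ ps) (_ , sep) (suc b) r = σ-adjacent-coord (q ∷ ps) sep b r

  toList-zipWith-cong : ∀ {n} {f g : Carrier → Carrier → Carrier} →
    (∀ {a a′ b b′} → a ≈ a′ → b ≈ b′ → f a b ≈ g a′ b′) →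
    ∀ {xs ys : Vec Carrier n} {xs′ ys′} → Vec.toList xs ≋ xs′ → Vec.toList ys ≋ ys′ →
    Vec.toList (Vec.zipWith f xs ys) ≋ List.zipWith g xs′ ys′
  toList-zipWith-cong f≈g {[]} {[]} [] [] = []
  toList-zipWith-cong f≈g {_ ∷ _} {_ ∷ _} (x≈ ∷ xs≋) (y≈ ∷ ys≋) = f≈g x≈ y≈ ∷ toList-zipWith-cong f≈g xs≋ ys≋

  σᵛ≋σ₂ : ∀ {d} (p q : Vec Carrier (suc d)) (gap≉0 : ¬ (gap p q ≈ 0#)) {x₁ xs y₁ ys} (nz : ¬ (x₁ - y₁ ≈ 0#)) →
    Vec.toList p ≋ x₁ List.∷ xs → Vec.toList q ≋ y₁ List.∷ ys → Vec.toList (σᵛ p q gap≉0) ≋ σ₂ x₁ xs y₁ ys nz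
  σᵛ≋σ₂ (_ ∷ _) (_ ∷ _) gap≉0 nz (x≈ ∷ xs≋) (y≈ ∷ ys≋) = toList-zipWith-cong
    (λ a≈ b≈ → *-cong (+-cong a≈ (-‿cong b≈)) (inv-cong gap≉0 nz (+-cong x≈ (-‿cong y≈)))) xs≋ ys≋

  σᵛ-irrelevant : ∀ {d} (p q : Vec Carrier (suc d)) gap≉0 gap≉0′ →
    Vec.toList (σᵛ p q gap≉0) ≋ Vec.toList (σᵛ p q gap≉0′)
  σᵛ-irrelevant p@(_ ∷ _) q@(_ ∷ _) gap≉0 gap≉0′ =
    ≋-trans (σᵛ≋σ₂ p q gap≉0 gap≉0′ ≋-refl ≋-refl) (≋-sym (σᵛ≋σ₂ p q gap≉0′ gap≉0′ ≋-refl ≋-refl))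

  _≋ᵛ_ : ∀ {n} → Vec (List Carrier) n → Vec (List Carrier) n → Set (c ⊔ ℓ)
  _≋ᵛ_ = Vecʷ.Pointwise _≋_

  ≋ᵛ-vinit : ∀ {n} {xs ys : Vec (List Carrier) (suc n)} → xs ≋ᵛ ys → vinit xs ≋ᵛ vinit ys
  ≋ᵛ-vinit (x≋ Vecʷ.∷ Vecʷ.[]) = Vecʷ.[]
  ≋ᵛ-vinit (x≋ Vecʷ.∷ xs≋@(_ Vecʷ.∷ _)) = x≋ Vecʷ.∷ ≋ᵛ-vinit xs≋

  σ-adjacent-vinit : ∀ {d n} (ps : Vec (Vec Carrier (suc d)) (suc (suc n))) (sep : Separated ps)
    (sep′ : Separated (vinit ps)) → toLists (σ-adjacent (vinit ps) sep′) ≋ᵛ vinit (toLists (σ-adjacent ps sep))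
  σ-adjacent-vinit (p ∷ q ∷ []) _ _ = Vecʷ.[]
  σ-adjacent-vinit (p ∷ q ∷ r ∷ ps) (gap≉0 , sep) (gap≉0′ , sep′) =
    σᵛ-irrelevant p q gap≉0′ gap≉0 Vecʷ.∷ σ-adjacent-vinit (q ∷ r ∷ ps) sep sep′

  -- Sig up to ≈ in the points and in the value: the σ of one pair computed in two
  -- overlapping subtrees carries two different proofs of nonvanishing, so the
  -- results agree only up to ≈.
  data Sig≈ : ∀ {n} → Vec (List Carrier) n → List Carrier → Set (c ⊔ ℓ) where
    base : ∀ {p v} → p ≋ v → Sig≈ (p ∷ []) v
    step : ∀ {k} {ps : Vec (List Carrier) (suc (suc k))} {x₁ y₁ xs ys v} →
           Sig≈ (vinit ps) (x₁ List.∷ xs) → Sig≈ (Vec.tail ps) (y₁ List.∷ ys) →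
           (nz : ¬ (x₁ - y₁ ≈ 0#)) → σ₂ x₁ xs y₁ ys nz ≋ v → Sig≈ ps v

  Sig⇒Sig≈ : ∀ {n} {ps : Vec (List Carrier) n} {v} → Sig ps v → Sig≈ ps v
  Sig⇒Sig≈ (Sig.base p) = base ≋-refl
  Sig⇒Sig≈ (Sig.step s₁ s₂ nz) = step (Sig⇒Sig≈ s₁) (Sig⇒Sig≈ s₂) nz ≋-refl

  Sig≈-resp-≋ᵛ : ∀ {n} {ps qs : Vec (List Carrier) n} {v} → ps ≋ᵛ qs → Sig≈ ps v → Sig≈ qs v
  Sig≈-resp-≋ᵛ (p≋q Vecʷ.∷ Vecʷ.[]) (base p≋v) = base (≋-trans (≋-sym p≋q) p≋v)
  Sig≈-resp-≋ᵛ ps≋qs@(_ Vecʷ.∷ tail≋) (step s₁ s₂ nz σ≋v) =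
    step (Sig≈-resp-≋ᵛ (≋ᵛ-vinit ps≋qs) s₁) (Sig≈-resp-≋ᵛ tail≋ s₂) nz σ≋v

  Sig≈-σ-adjacent : ∀ {d m} (ps : Vec (Vec Carrier (suc d)) (suc (suc m))) {v} → Sig≈ (toLists ps) v →
    Σ (Separated ps) λ sep → Sig≈ (toLists (σ-adjacent ps sep)) v
  Sig≈-σ-adjacent {m = zero} (p@(_ ∷ _) ∷ q@(_ ∷ _) ∷ []) (step (base p≋@(x≈ ∷ _)) (base q≋@(y≈ ∷ _)) nz σ≋v) =
    (gap≉0 , _) , base (≋-trans (σᵛ≋σ₂ p q gap≉0 nz p≋ q≋) σ≋v)
    where
    gap≉0 : ¬ (gap p q ≈ 0#)
    gap≉0 gap≈0 = nz (trans (sym (+-cong x≈ (-‿cong y≈))) gap≈0)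
  Sig≈-σ-adjacent {m = suc m} ps@(_ ∷ _ ∷ _ ∷ _) (step {x₁ = x₁} {y₁ = y₁} {xs = xs} {ys = ys} s₁ s₂ nz σ≋v) = sep , step s₁′ (proj₂ ih₂) nz σ≋v
    where
    ih₁ : Σ (Separated (vinit ps)) λ sep → Sig≈ (toLists (σ-adjacent (vinit ps) sep)) (x₁ List.∷ xs)
    ih₁ = Sig≈-σ-adjacent (vinit ps) (≡.subst (λ qs → Sig≈ qs (x₁ List.∷ xs)) (vinit-map Vec.toList ps) s₁)
    ih₂ : Σ (Separated (Vec.tail ps)) λ sep → Sig≈ (toLists (σ-adjacent (Vec.tail ps) sep)) (y₁ List.∷ ys)
    ih₂ = Sig≈-σ-adjacent (Vec.tail ps) s₂
    sep : Separated ps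
    sep = proj₁ (proj₁ ih₁) , proj₁ ih₂
    s₁′ : Sig≈ (vinit (toLists (σ-adjacent ps sep))) (x₁ List.∷ xs)
    s₁′ = Sig≈-resp-≋ᵛ (σ-adjacent-vinit ps sep (proj₁ ih₁)) (proj₂ ih₁)

  toList≋map-applyUpTo : ∀ {d} (p : Vec Carrier d) (f : ℕ → ℕ) (g : ℕ → Carrier) →
    (∀ i → g (f i) ≈ nth (Vec.toList p) i) → Vec.toList p ≋ List.map g (List.applyUpTo f d)
  toList≋map-applyUpTo [] f g _ = []
  toList≋map-applyUpTo (x ∷ p) f g g∘f≈p =
    sym (g∘f≈p zero) ∷ toList≋map-applyUpTo p (λ i → f (suc i)) g (λ i → g∘f≈p (suc i))

  map∘map-≋ : ∀ {F G : ℕ → Carrier} {f g : ℕ → ℕ} (xs : List ℕ) → (∀ i → F (f i) ≈ G (g i)) →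
    List.map F (List.map f xs) ≋ List.map G (List.map g xs)
  map∘map-≋ List.[] _ = []
  map∘map-≋ (x List.∷ xs) F∘f≈G∘g = F∘f≈G∘g x ∷ map∘map-≋ xs F∘f≈G∘g

  σ-formula : ∀ m d → suc m ≤ d → (ps : Vec (Vec Carrier d) (suc m)) {v : List Carrier} →
    Sig≈ (toLists ps) v →
    Σ (¬ (D ps m ≈ 0#)) λ D≉0 → v ≋ List.map (λ j → D ps j * inv (D ps m) D≉0) (range (suc m) d)
  σ-formula zero d _ (p ∷ []) (base p≋v) = D₀≉0 , ≋-trans (≋-sym p≋v)
    (≋-trans (toList≋map-applyUpTo p (λ i → i) _ quotient≈coord) (≋-reflexive (List.map-∘ (List.upTo d))))
    where
    D₀≉0 : ¬ (D (p ∷ []) 0 ≈ 0#)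
    D₀≉0 D₀≈0 = 1≉0 (trans (sym (D-single p 0)) D₀≈0)
    quotient≈coord : ∀ i → D (p ∷ []) (i ℕ.+ 1) * inv (D (p ∷ []) 0) D₀≉0 ≈ nth (Vec.toList p) i
    quotient≈coord i = begin
      D (p ∷ []) (i ℕ.+ 1) * inv (D (p ∷ []) 0) D₀≉0
        ≈⟨ *-cong (D-single p (i ℕ.+ 1)) (trans (inv-cong D₀≉0 1≉0 (D-single p 0)) inv-1) ⟩
      coord p (i ℕ.+ 1) * 1#  ≈⟨ *-identityʳ _ ⟩
      coord p (i ℕ.+ 1)       ≡⟨ ≡.cong (coord p) (ℕ.+-comm i 1) ⟩
      coord p (suc i)         ∎
  σ-formula (suc m) (suc d) (s≤s m<d) ps {v} sig =
    -- range (suc m) d and range (suc (suc m)) (suc d) are both shifts of upTo (d ∸ m).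
    D≉0 , ≋-trans (proj₂ ih) (map∘map-≋ (List.upTo (d ∸ m)) same-quotient)
    where
    separated : Σ (Separated ps) λ sep → Sig≈ (toLists (σ-adjacent ps sep)) v
    separated = Sig≈-σ-adjacent ps sig
    qs : Vec (Vec Carrier d) (suc m)
    qs = σ-adjacent ps (proj₁ separated)
    ih : Σ (¬ (D qs m ≈ 0#)) λ D≉0 → v ≋ List.map (λ j → D qs j * inv (D qs m) D≉0) (range (suc m) d)
    ih = σ-formula m d m<d qs (proj₂ separated)
    K : Carrier
    K = sgn (suc m) * prodF (suc m) (gaps ps)
    D-reduction : ∀ j → D ps (suc j) ≈ K * D qs j
    D-reduction = D-column-differences ps qs (gaps ps) (σ-adjacent-coord ps (proj₁ separated))
    K≉0 : ¬ (K ≈ 0#)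
    K≉0 = x*y≉0 (sgn≉0 (suc m)) (prodF≉0 (suc m) (gaps ps) (gaps≉0 ps (proj₁ separated)))
    D≉0 : ¬ (D ps (suc m) ≈ 0#)
    D≉0 D≈0 = x*y≉0 K≉0 (proj₁ ih) (trans (sym (D-reduction m)) D≈0)
    same-quotient : ∀ i → D qs (i ℕ.+ suc m) * inv (D qs m) (proj₁ ih) ≈
                          D ps (i ℕ.+ suc (suc m)) * inv (D ps (suc m)) D≉0
    same-quotient i = sym (trans (*-congʳ (reflexive (≡.cong (D ps) (ℕ.+-suc i (suc m)))))
                                 (quotient-cancel D≉0 (proj₁ ih) (D-reduction (i ℕ.+ suc m)) (D-reduction m)))

lemma3p3 : ∀ {c ℓ} (F : Field c ℓ) →
    let open Field F in let open FieldDefs F in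
    (d k : ℕ) → 1 ≤ k → k ≤ d →
    (ps : Vec (Vec Carrier d) k) (v : List Carrier) →
    Sig (Vec.map Vec.toList ps) v →
    Σ (¬ (D ps (k ∸ 1) ≈ 0#)) λ nz →
      Pointwise _≈_ v (List.map (λ j → D ps j * inv (D ps (k ∸ 1)) nz) (range k d))
lemma3p3 F d (suc m) _ k≤d ps v sig = σ-formula F m d k≤d ps (Sig⇒Sig≈ F sig)
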